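{- Let $\Gamma$ be a strictly Deza graph with parameters $(n,k,b,a)$ such that $k=b+1$ and $\beta(\Gamma)>1$. For any vertices $u,v$ of $\Gamma$, if $B[v]\cap B[u]\neq\emptyset$ then $B[v]=B[u]$.
   Context: Graphs are finite, simple, undirected. $N(v)$ is the neighbourhood of $v$. A Deza graph with parameters $(n,k,b,a)$, $b\ge a$, is a nonempty $k$-regular graph on $n$ vertices in which every pair of distinct vertices has exactly $b$ or exactly $a$ common neighbours; it is strictly Deza if it has diameter $2$ and is not strongly regular. $B(v)=\{u: |N(u)\cap N(v)|=b\}$, $B[v]=B(v)\cup\{v\}$; $\beta(\Gamma)=|B(v)|$ (independent of $v$). -}

module Defs where

open import Data.Nat using (ℕ; _≤_; _<_; _+_)
open import Data.Bool using (Bool; true; false; _∧_)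
open import Data.List using (length; filterᵇ)
open import Data.List using (List)
open import Data.Fin using (Fin) renaming (_≟_ to _≟F_)
open import Data.Nat using () renaming (_≟_ to _≟ℕ_)
open import Data.Product using (Σ; ∃; _×_; _,_)
open import Data.Sum using (_⊎_)
open import Relation.Nullary using (¬_)
open import Relation.Nullary.Decidable using (⌊_⌋; ¬?)
open import Relation.Binary.PropositionalEquality using (_≡_; _≢_)
import Data.List as L

allFin : (n : ℕ) → List (Fin n)
allFin n = L.allFin n

count : {n : ℕ} → (Fin n → Bool) → ℕ
count {n} p = length (filterᵇ p (allFin n))

record Graph (n : ℕ) : Set where
  field
    adj    : Fin n → Fin n → Bool
    sym    : ∀ u v → adj u v ≡ adj v u
    irrefl : ∀ v → adj v v ≡ false

module _ {n : ℕ} (G : Graph n) where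
  open Graph G

  Adj : Fin n → Fin n → Set
  Adj u v = adj u v ≡ true

  degree : Fin n → ℕ
  degree v = count (adj v)

  codeg : Fin n → Fin n → ℕ
  codeg u v = count (λ w → adj u w ∧ adj v w)

  IsRegular : ℕ → Set
  IsRegular k = ∀ v → degree v ≡ k

  IsDeza : ℕ → ℕ → ℕ → Set
  IsDeza k b a =
    (1 ≤ n) × (a ≤ b) × IsRegular k ×
    (∀ u v → u ≢ v → (codeg u v ≡ b) ⊎ (codeg u v ≡ a))

  HasDiameter2 : Set
  HasDiameter2 =
    (∀ u v → (u ≡ v) ⊎ (Adj u v ⊎ ∃ (λ w → Adj u w × Adj w v))) ×
    ∃ (λ u → ∃ (λ v → u ≢ v × ¬ Adj u v))

  IsStronglyRegular : Set
  IsStronglyRegular =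
    ∃ (λ k → ∃ (λ l → ∃ (λ m →
      IsRegular k ×
      (∀ u v → u ≢ v → Adj u v → codeg u v ≡ l) ×
      (∀ u v → u ≢ v → ¬ Adj u v → codeg u v ≡ m))))

  IsStrictlyDeza : ℕ → ℕ → ℕ → Set
  IsStrictlyDeza k b a = IsDeza k b a × HasDiameter2 × ¬ IsStronglyRegular

  InB : ℕ → Fin n → Fin n → Set
  InB b v u = u ≢ v × codeg u v ≡ b

  InBc : ℕ → Fin n → Fin n → Set
  InBc b v u = (u ≡ v) ⊎ InB b v u

  sizeB : ℕ → Fin n → ℕ
  sizeB b v = count (λ u → ⌊ ¬? (u ≟F v) ⌋ ∧ ⌊ codeg u v ≟ℕ b ⌋)

module Submission where

-- Inclusion–exclusion inside N(v) shows that for v ∈ B(u) and w ∈ B(v) the vertices u and w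
-- have at least 2b − k = b − 1 common neighbours, so B[·] is an equivalence relation unless
-- a = b − 1. That case is impossible: for b = 1 the graph is 2-regular of diameter 2 and the
-- Deza condition makes it strongly regular with λ = 0, μ = 1; for b ≥ 2 the Deza identity
-- k(k − 1) = bβ + a(n − 1 − β) is violated once β ≥ 2 and n ≥ k + 3, the latter because
-- p, a non-neighbour q of p and a neighbour of q outside N(p) all lie outside N(p).

open import Defs
open import Data.Bool using (Bool; true; false; _∧_; not)
open import Data.Bool.Properties using (∧-comm; ∧-idem; ¬-not)
open import Data.Fin using (Fin; zero; suc; _≟_)
open import Data.Fin.Properties using (¬∀⟶∃¬)
open import Data.List using (length; filterᵇ; tabulate)
open import Data.Nat using (ℕ; zero; suc; _+_; _*_; _≤_; _<_; _≤?_; z≤n; s≤s; z<s)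
open import Data.Nat using () renaming (_≟_ to _≟ℕ_)
open import Data.Nat.Properties hiding (_≟_)
open import Algebra.Properties.Semiring.Sum +-*-semiring
  using (sum; sum-syntax; sum-cong-≗; ∑-distrib-+; ∑-comm; *-distribˡ-sum; *-distribʳ-sum)
open import Data.Nat.Tactic.RingSolver using (solve-∀)
open import Data.Sum using (_⊎_; inj₁; inj₂; [_,_]′)
open import Data.Product using (∃; _×_; _,_; proj₁; map₂)
open import Function using (_∘_)
open import Relation.Binary.PropositionalEquality
open import Relation.Binary.Structures using (IsEquivalence)
open import Relation.Nullary using (¬_; Dec; yes; no; contradiction)
open import Relation.Nullary.Decidable using (⌊_⌋; ¬?)

𝟙 : Bool → ℕ
𝟙 true  = 1
𝟙 false = 0

𝟙-∧ : ∀ x y → 𝟙 (x ∧ y) ≡ 𝟙 x * 𝟙 y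
𝟙-∧ true  y = sym (+-identityʳ (𝟙 y))
𝟙-∧ false y = refl

𝟙+𝟙-not : ∀ x → 𝟙 x + 𝟙 (not x) ≡ 1
𝟙+𝟙-not true  = refl
𝟙+𝟙-not false = refl

𝟙-<⇒ : ∀ {x y} → 𝟙 x < 𝟙 y → y ≡ true × x ≡ false
𝟙-<⇒ {false} {true} _ = refl , refl
𝟙-<⇒ {true}  {true} (s≤s ())
𝟙-<⇒ {_}     {false} ()

∧≡true⇒ : ∀ {x y} → x ∧ y ≡ true → x ≡ true × y ≡ true
∧≡true⇒ {true} {true} _ = refl , refl

𝟙-∧-incl : ∀ x y z → 𝟙 (x ∧ y) + 𝟙 (y ∧ z) ≤ 𝟙 y + 𝟙 (x ∧ z)
𝟙-∧-incl true  true  z     = ≤-refl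
𝟙-∧-incl true  false z     = z≤n
𝟙-∧-incl false true  true  = ≤-refl
𝟙-∧-incl false true  false = z≤n
𝟙-∧-incl false false z     = z≤n

sum-mono-≤ : ∀ {n} {f g : Fin n → ℕ} → (∀ i → f i ≤ g i) → sum f ≤ sum g
sum-mono-≤ {zero}  f≤g = z≤n
sum-mono-≤ {suc n} f≤g = +-mono-≤ (f≤g zero) (sum-mono-≤ (f≤g ∘ suc))

sum-<⇒∃< : ∀ {n} (f g : Fin n → ℕ) → sum f < sum g → ∃ λ i → f i < g i
sum-<⇒∃< {n} f g ∑f<∑g =
  map₂ ≰⇒> (¬∀⟶∃¬ n (λ i → g i ≤ f i) (λ i → g i ≤? f i) λ g≤f → <⇒≱ ∑f<∑g (sum-mono-≤ g≤f))

sum-const : ∀ n c → ∑[ i < n ] c ≡ n * c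
sum-const zero    c = refl
sum-const (suc n) c = cong (c +_) (sum-const n c)

sum-𝟙-≟ : ∀ {n} (j : Fin n) → ∑[ i < n ] 𝟙 ⌊ i ≟ j ⌋ ≡ 1
sum-𝟙-≟ {suc n} zero    = cong suc (trans (sum-const n 0) (*-zeroʳ n))
sum-𝟙-≟ {suc n} (suc j) = trans (sum-cong-≗ (cong 𝟙 ∘ ⌊suc≟suc⌋)) (sum-𝟙-≟ j)
  where
  ⌊suc≟suc⌋ : ∀ i → ⌊ suc i ≟ suc j ⌋ ≡ ⌊ i ≟ j ⌋
  ⌊suc≟suc⌋ i with i ≟ j
  ... | yes _ = refl
  ... | no  _ = refl

count≡sum : ∀ {n} (p : Fin n → Bool) → count p ≡ ∑[ i < n ] 𝟙 (p i)
count≡sum {n} p = length-filter-tabulate n (λ i → i)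
  where
  length-filter-tabulate : ∀ m (f : Fin m → Fin n) → length (filterᵇ p (tabulate f)) ≡ ∑[ i < m ] 𝟙 (p (f i))
  length-filter-tabulate zero    f = refl
  length-filter-tabulate (suc m) f with p (f zero)
  ... | true  = cong suc (length-filter-tabulate m (f ∘ suc))
  ... | false = length-filter-tabulate m (f ∘ suc)

module _ {n : ℕ} where

  count-cong : ∀ {p q : Fin n → Bool} → (∀ i → p i ≡ q i) → count p ≡ count q
  count-cong {p} {q} p≗q = trans (count≡sum p) (trans (sum-cong-≗ (cong 𝟙 ∘ p≗q)) (sym (count≡sum q)))

  count-false : count {n} (λ _ → false) ≡ 0
  count-false = trans (count≡sum {n} (λ _ → false)) (trans (sum-const n 0) (*-zeroʳ n))

  count+count-not : ∀ (p : Fin n → Bool) → count p + count (not ∘ p) ≡ n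
  count+count-not p = begin
    count p + count (not ∘ p)                      ≡⟨ cong₂ _+_ (count≡sum p) (count≡sum (not ∘ p)) ⟩
    ∑[ i < n ] 𝟙 (p i) + ∑[ i < n ] 𝟙 (not (p i))  ≡⟨ ∑-distrib-+ (𝟙 ∘ p) (𝟙 ∘ not ∘ p) ⟨
    ∑[ i < n ] (𝟙 (p i) + 𝟙 (not (p i)))           ≡⟨ sum-cong-≗ (𝟙+𝟙-not ∘ p) ⟩
    ∑[ i < n ] 1                                   ≡⟨ sum-const n 1 ⟩
    n * 1                                          ≡⟨ *-identityʳ n ⟩
    n                                              ∎
    where open ≡-Reasoning

  count-<⇒∃ : ∀ {p q : Fin n → Bool} → count q < count p → ∃ λ i → p i ≡ true × q i ≡ false
  count-<⇒∃ {p} {q} lt = map₂ 𝟙-<⇒ (sum-<⇒∃< _ _ (subst₂ _<_ (count≡sum q) (count≡sum p) lt))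

  count-pos⇒∃ : ∀ {p : Fin n → Bool} → 0 < count p → ∃ λ i → p i ≡ true
  count-pos⇒∃ {p} pos = map₂ proj₁ (count-<⇒∃ {q = λ _ → false} (subst (_< count p) (sym count-false) pos))

  ∈⇒1≤count : ∀ {p : Fin n → Bool} {x} → p x ≡ true → 1 ≤ count p
  ∈⇒1≤count {p} {x} px = begin
    1                         ≡⟨ sum-𝟙-≟ x ⟨
    ∑[ i < n ] 𝟙 ⌊ i ≟ x ⌋   ≤⟨ sum-mono-≤ point≤p ⟩
    ∑[ i < n ] 𝟙 (p i)       ≡⟨ count≡sum p ⟨
    count p                   ∎
    where
    open ≤-Reasoning
    point≤p : ∀ i → 𝟙 ⌊ i ≟ x ⌋ ≤ 𝟙 (p i)
    point≤p i with i ≟ x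
    ... | yes refl = ≤-reflexive (cong 𝟙 (sym px))
    ... | no  _    = z≤n

  distinct∈⇒3≤count : ∀ {p : Fin n → Bool} {x y z} → p x ≡ true → p y ≡ true → p z ≡ true →
                       x ≢ y → x ≢ z → y ≢ z → 3 ≤ count p
  distinct∈⇒3≤count {p} {x} {y} {z} px py pz x≢y x≢z y≢z = begin
    3                                        ≡⟨ cong₂ _+_ (cong₂ _+_ (sum-𝟙-≟ x) (sum-𝟙-≟ y)) (sum-𝟙-≟ z) ⟨
    ∑ 𝟙x + ∑ 𝟙y + ∑ 𝟙z                       ≡⟨ cong (_+ ∑ 𝟙z) (∑-distrib-+ 𝟙x 𝟙y) ⟨
    ∑[ i < n ] (𝟙x i + 𝟙y i) + ∑ 𝟙z          ≡⟨ ∑-distrib-+ _ 𝟙z ⟨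
    ∑[ i < n ] (𝟙x i + 𝟙y i + 𝟙z i)          ≤⟨ sum-mono-≤ points≤p ⟩
    ∑[ i < n ] 𝟙 (p i)                       ≡⟨ count≡sum p ⟨
    count p                                  ∎
    where
    open ≤-Reasoning
    ∑ : (Fin n → ℕ) → ℕ
    ∑ = sum
    𝟙x 𝟙y 𝟙z : Fin n → ℕ
    𝟙x i = 𝟙 ⌊ i ≟ x ⌋
    𝟙y i = 𝟙 ⌊ i ≟ y ⌋
    𝟙z i = 𝟙 ⌊ i ≟ z ⌋
    points≤p : ∀ i → 𝟙x i + 𝟙y i + 𝟙z i ≤ 𝟙 (p i)
    points≤p i with i ≟ x | i ≟ y | i ≟ z
    ... | yes refl | yes refl | _        = contradiction refl x≢y
    ... | yes refl | _        | yes refl = contradiction refl x≢z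
    ... | _        | yes refl | yes refl = contradiction refl y≢z
    ... | yes refl | no _     | no _     = ≤-reflexive (cong 𝟙 (sym px))
    ... | no _     | yes refl | no _     = ≤-reflexive (cong 𝟙 (sym py))
    ... | no _     | no _     | yes refl = ≤-reflexive (cong 𝟙 (sym pz))
    ... | no _     | no _     | no _     = z≤n

-- After writing n = 6 + c + m and β = 2 + t, the right-hand side exceeds the left by 1 + c + t + m(1 + c).
deza-identity-unsatisfiable : ∀ c {n β} → 3 + c + 3 ≤ n → 2 ≤ β →
  (3 + c) * (3 + c) + (1 + c + β * (1 + c)) ≢ n * (1 + c) + (3 + c + β * (2 + c))
deza-identity-unsatisfiable c n≥k+3 β≥2
  with m , refl ← m≤n⇒∃[o]m+o≡n n≥k+3 | t , refl ← m≤n⇒∃[o]m+o≡n β≥2 =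
  λ identity → m+1+n≢m _ (sym (trans identity (excess c m t)))
  where
  excess : ∀ c m t → (3 + c + 3 + m) * (1 + c) + (3 + c + (2 + t) * (2 + c))
                     ≡ (3 + c) * (3 + c) + (1 + c + (2 + t) * (1 + c)) + suc (c + t + m * (1 + c))
  excess = solve-∀

b+b≤1+b+a⇒a≡b : ∀ {a b} → a ≤ b → b ≢ suc a → b + b ≤ suc b + a → a ≡ b
b+b≤1+b+a⇒a≡b {a} {b} a≤b b≢1+a b+b≤1+b+a with m≤n⇒m<n∨m≡n a≤b
... | inj₂ a≡b = a≡b
... | inj₁ a<b = contradiction (≤-antisym b≤1+a a<b) b≢1+a
  where
  b≤1+a : b ≤ suc a
  b≤1+a = +-cancelˡ-≤ b b (suc a) (subst (b + b ≤_) (sym (+-suc b a)) b+b≤1+b+a)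

overlapping-classes⊆ : ∀ {A : Set} {R : A → A → Set} → IsEquivalence R →
                       ∀ {u v w} → R v w → R u w → ∀ x → R v x → R u x
overlapping-classes⊆ equiv v~w u~w x v~x = R.trans u~w (R.trans (R.sym v~w) v~x)
  where module R = IsEquivalence equiv

module _ {n : ℕ} (G : Graph n) where
  open Graph G using (adj; irrefl) renaming (sym to adj-sym)

  Adj-sym : ∀ {u v} → Adj G u v → Adj G v u
  Adj-sym {u} {v} u~v = trans (adj-sym v u) u~v

  Adj⇒≢ : ∀ {u v} → Adj G u v → u ≢ v
  Adj⇒≢ {u} u~u refl with () ← trans (sym u~u) (irrefl u)

  codeg-sym : ∀ u v → codeg G u v ≡ codeg G v u
  codeg-sym u v = count-cong (λ w → ∧-comm (adj u w) (adj v w))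

  codeg-self : ∀ v → codeg G v v ≡ degree G v
  codeg-self v = count-cong (λ w → ∧-idem (adj v w))

  degree≡sum : ∀ v → degree G v ≡ ∑[ w < n ] 𝟙 (adj v w)
  degree≡sum v = count≡sum (adj v)

  codeg≡sum : ∀ u v → codeg G u v ≡ ∑[ w < n ] 𝟙 (adj u w ∧ adj v w)
  codeg≡sum u v = count≡sum (λ w → adj u w ∧ adj v w)

  common-neighbour⇒1≤codeg : ∀ {u v w} → Adj G u w → Adj G v w → 1 ≤ codeg G u v
  common-neighbour⇒1≤codeg {u} {v} u~w v~w = ∈⇒1≤count {p = λ w → adj u w ∧ adj v w} (cong₂ _∧_ u~w v~w)

  0<codeg⇒common-neighbour : ∀ {u v} → 0 < codeg G u v → ∃ λ w → Adj G u w × Adj G v w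
  0<codeg⇒common-neighbour pos = map₂ ∧≡true⇒ (count-pos⇒∃ pos)

  codeg+codeg≤degree+codeg : ∀ x y z → codeg G x y + codeg G y z ≤ degree G y + codeg G x z
  codeg+codeg≤degree+codeg x y z = begin
    codeg G x y + codeg G y z
      ≡⟨ cong₂ _+_ (codeg≡sum x y) (codeg≡sum y z) ⟩
    ∑[ w < n ] 𝟙 (adj x w ∧ adj y w) + ∑[ w < n ] 𝟙 (adj y w ∧ adj z w)
      ≡⟨ ∑-distrib-+ (λ w → 𝟙 (adj x w ∧ adj y w)) _ ⟨
    ∑[ w < n ] (𝟙 (adj x w ∧ adj y w) + 𝟙 (adj y w ∧ adj z w))
      ≤⟨ sum-mono-≤ (λ w → 𝟙-∧-incl (adj x w) (adj y w) (adj z w)) ⟩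
    ∑[ w < n ] (𝟙 (adj y w) + 𝟙 (adj x w ∧ adj z w))
      ≡⟨ ∑-distrib-+ (λ w → 𝟙 (adj y w)) _ ⟩
    ∑[ w < n ] 𝟙 (adj y w) + ∑[ w < n ] 𝟙 (adj x w ∧ adj z w)
      ≡⟨ cong₂ _+_ (degree≡sum y) (codeg≡sum x z) ⟨
    degree G y + codeg G x z
      ∎
    where open ≤-Reasoning

  sum-codeg : ∀ {k} → IsRegular G k → ∀ p → ∑[ u < n ] codeg G u p ≡ k * k
  sum-codeg {k} regular p = begin
    ∑[ u < n ] codeg G u p                          ≡⟨ sum-cong-≗ (λ u → codeg≡sum u p) ⟩
    ∑[ u < n ] ∑[ w < n ] 𝟙 (adj u w ∧ adj p w)     ≡⟨ ∑-comm (λ u w → 𝟙 (adj u w ∧ adj p w)) ⟩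
    ∑[ w < n ] ∑[ u < n ] 𝟙 (adj u w ∧ adj p w)     ≡⟨ sum-cong-≗ column ⟩
    ∑[ w < n ] (k * 𝟙 (adj p w))                    ≡⟨ *-distribˡ-sum k (λ w → 𝟙 (adj p w)) ⟨
    k * ∑[ w < n ] 𝟙 (adj p w)                      ≡⟨ cong (k *_) (trans (sym (regular p)) (degree≡sum p)) ⟨
    k * k                                           ∎
    where
    open ≡-Reasoning
    column : ∀ w → ∑[ u < n ] 𝟙 (adj u w ∧ adj p w) ≡ k * 𝟙 (adj p w)
    column w = begin
      ∑[ u < n ] 𝟙 (adj u w ∧ adj p w)        ≡⟨ sum-cong-≗ (λ u → 𝟙-∧ (adj u w) (adj p w)) ⟩
      ∑[ u < n ] (𝟙 (adj u w) * 𝟙 (adj p w)) ≡⟨ *-distribʳ-sum (𝟙 (adj p w)) (λ u → 𝟙 (adj u w)) ⟨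
      (∑[ u < n ] 𝟙 (adj u w)) * 𝟙 (adj p w) ≡⟨ cong (_* 𝟙 (adj p w)) k≡∑ ⟨
      k * 𝟙 (adj p w)                        ∎
      where
      k≡∑ : k ≡ ∑[ u < n ] 𝟙 (adj u w)
      k≡∑ = begin
        k                          ≡⟨ regular w ⟨
        degree G w                 ≡⟨ count-cong (λ u → adj-sym w u) ⟩
        count (λ u → adj u w)      ≡⟨ count≡sum (λ u → adj u w) ⟩
        ∑[ u < n ] 𝟙 (adj u w)     ∎

  -- The standard Deza identity k(k − 1) = bβ + a(n − 1 − β), obtained by counting walks of
  -- length two from p and rearranged so that no subtraction occurs.
  deza-identity : ∀ {k b a} → IsDeza G k b a → ∀ p →
                  k * k + (a + sizeB G b p * a) ≡ n * a + (k + sizeB G b p * b)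
  deza-identity {k} {b} {a} (_ , _ , regular , codeg∈) p = begin
    k * k + (a + sizeB G b p * a)                   ≡⟨ cong₂ _+_ (sum-codeg regular p) (weighted a a) ⟨
    ∑[ u < n ] codeg G u p + ∑[ u < n ] (e u * a + β u * a)
                                                    ≡⟨ ∑-distrib-+ (λ u → codeg G u p) (λ u → e u * a + β u * a) ⟨
    ∑[ u < n ] (codeg G u p + (e u * a + β u * a))  ≡⟨ sum-cong-≗ (λ u → pointwise (u ≟ p) (codeg G u p ≟ℕ b)) ⟩
    ∑[ u < n ] (a + (e u * k + β u * b))            ≡⟨ ∑-distrib-+ (λ _ → a) (λ u → e u * k + β u * b) ⟩
    ∑[ u < n ] a + ∑[ u < n ] (e u * k + β u * b)   ≡⟨ cong₂ _+_ (sum-const n a) (weighted k b) ⟩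
    n * a + (k + sizeB G b p * b)                   ∎
    where
    open ≡-Reasoning
    inB : Fin n → Bool
    inB u = ⌊ ¬? (u ≟ p) ⌋ ∧ ⌊ codeg G u p ≟ℕ b ⌋
    e β : Fin n → ℕ
    e u = 𝟙 ⌊ u ≟ p ⌋
    β u = 𝟙 (inB u)

    weighted : ∀ c d → ∑[ u < n ] (e u * c + β u * d) ≡ c + sizeB G b p * d
    weighted c d = begin
      ∑[ u < n ] (e u * c + β u * d)                    ≡⟨ ∑-distrib-+ (λ u → e u * c) (λ u → β u * d) ⟩
      ∑[ u < n ] (e u * c) + ∑[ u < n ] (β u * d)       ≡⟨ cong₂ _+_ (*-distribʳ-sum c e) (*-distribʳ-sum d β) ⟨
      (∑[ u < n ] e u) * c + (∑[ u < n ] β u) * d       ≡⟨ cong₂ (λ s t → s * c + t * d) (sum-𝟙-≟ p) (sym (count≡sum inB)) ⟩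
      1 * c + sizeB G b p * d                           ≡⟨ cong (_+ sizeB G b p * d) (*-identityˡ c) ⟩
      c + sizeB G b p * d                               ∎

    pointwise : ∀ {u} (u≟p : Dec (u ≡ p)) (u≟b : Dec (codeg G u p ≡ b)) →
                codeg G u p + (𝟙 ⌊ u≟p ⌋ * a + 𝟙 (⌊ ¬? u≟p ⌋ ∧ ⌊ u≟b ⌋) * a)
                  ≡ a + (𝟙 ⌊ u≟p ⌋ * k + 𝟙 (⌊ ¬? u≟p ⌋ ∧ ⌊ u≟b ⌋) * b)
    pointwise (yes refl) _ = trans (cong (_+ (1 * a + 0 * a)) (trans (codeg-self p) (regular p))) (swap k a b)
      where
      swap : ∀ x y z → x + (1 * y + 0 * y) ≡ y + (1 * x + 0 * z)
      swap = solve-∀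
    pointwise (no u≢p) (yes codeg≡b) rewrite codeg≡b = swap k a b
      where
      swap : ∀ x y z → z + (0 * y + 1 * y) ≡ y + (0 * x + 1 * z)
      swap = solve-∀
    pointwise {u} (no u≢p) (no codeg≢b) with codeg∈ u p u≢p
    ... | inj₁ codeg≡b = contradiction codeg≡b codeg≢b
    ... | inj₂ codeg≡a rewrite codeg≡a = refl

  degree+3≤n : ∀ {p q} → p ≢ q → ¬ Adj G p q → codeg G q p < degree G q → degree G p + 3 ≤ n
  degree+3≤n {p} {q} p≢q p≁q codeg<degree
    with r , q~r , q~r∧p~r≡false ← count-<⇒∃ {p = adj q} {q = λ w → adj q w ∧ adj p w} codeg<degree
    = begin
      degree G p + 3                       ≤⟨ +-monoʳ-≤ (degree G p) three-non-neighbours ⟩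
      degree G p + count (not ∘ adj p)     ≡⟨ count+count-not (adj p) ⟩
      n                                    ∎
    where
    open ≤-Reasoning
    three-non-neighbours : 3 ≤ count (not ∘ adj p)
    three-non-neighbours = distinct∈⇒3≤count
      (cong not (irrefl p)) (cong not (¬-not p≁q))
      (cong not (subst (λ x → x ∧ adj p r ≡ false) q~r q~r∧p~r≡false))
      p≢q (λ { refl → p≁q (Adj-sym q~r) }) (Adj⇒≢ q~r)

  degree≡2⇒neighbour : ∀ {x y z t} → degree G x ≡ 2 → Adj G x y → Adj G x z → y ≢ z →
                       Adj G x t → t ≡ y ⊎ t ≡ z
  degree≡2⇒neighbour {x} {y} {z} {t} deg≡2 x~y x~z y≢z x~t with t ≟ y | t ≟ z
  ... | yes t≡y | _       = inj₁ t≡y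
  ... | no _    | yes t≡z = inj₂ t≡z
  ... | no t≢y  | no t≢z  = contradiction (subst (3 ≤_) deg≡2 three-neighbours) (<⇒≱ (n<1+n 2))
    where
    three-neighbours : 3 ≤ degree G x
    three-neighbours = distinct∈⇒3≤count x~y x~z x~t y≢z (t≢y ∘ sym) (t≢z ∘ sym)

  2-regular-triangle⇒complete : IsRegular G 2 → HasDiameter2 G → ∀ {u v w} →
                                Adj G u v → Adj G u w → Adj G v w → ∀ {x y} → x ≢ y → Adj G x y
  2-regular-triangle⇒complete regular (within2 , _) {u} {v} {w} u~v u~w v~w {x} {y} x≢y =
    adjacent (on-triangle x) (on-triangle y) x≢y
    where
    neighbour : ∀ {s y z t} → Adj G s y → Adj G s z → y ≢ z → Adj G s t → t ≡ y ⊎ t ≡ z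
    neighbour = degree≡2⇒neighbour (regular _)

    On△ : Fin n → Set
    On△ s = s ≡ u ⊎ s ≡ v ⊎ s ≡ w

    on-triangle : ∀ s → On△ s
    on-triangle s with within2 u s
    ... | inj₁ u≡s = inj₁ (sym u≡s)
    ... | inj₂ (inj₁ u~s) = inj₂ (neighbour u~v u~w (Adj⇒≢ v~w) u~s)
    ... | inj₂ (inj₂ (m , u~m , m~s)) with neighbour u~v u~w (Adj⇒≢ v~w) u~m
    ...   | inj₁ refl = [ inj₁ , inj₂ ∘ inj₂ ]′ (neighbour (Adj-sym u~v) v~w (Adj⇒≢ u~w) m~s)
    ...   | inj₂ refl = [ inj₁ , inj₂ ∘ inj₁ ]′ (neighbour (Adj-sym u~w) (Adj-sym v~w) (Adj⇒≢ u~v) m~s)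

    adjacent : ∀ {s t} → On△ s → On△ t → s ≢ t → Adj G s t
    adjacent (inj₁ refl)        (inj₁ refl)        s≢t = contradiction refl s≢t
    adjacent (inj₁ refl)        (inj₂ (inj₁ refl)) _   = u~v
    adjacent (inj₁ refl)        (inj₂ (inj₂ refl)) _   = u~w
    adjacent (inj₂ (inj₁ refl)) (inj₁ refl)        _   = Adj-sym u~v
    adjacent (inj₂ (inj₁ refl)) (inj₂ (inj₁ refl)) s≢t = contradiction refl s≢t
    adjacent (inj₂ (inj₁ refl)) (inj₂ (inj₂ refl)) _   = v~w
    adjacent (inj₂ (inj₂ refl)) (inj₁ refl)        _   = Adj-sym u~w
    adjacent (inj₂ (inj₂ refl)) (inj₂ (inj₁ refl)) _   = Adj-sym v~w
    adjacent (inj₂ (inj₂ refl)) (inj₂ (inj₂ refl)) s≢t = contradiction refl s≢t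

  ¬strictlyDeza-2-1-0 : ¬ IsStrictlyDeza G 2 1 0
  ¬strictlyDeza-2-1-0 ((_ , _ , regular , codeg∈) , diameter2@(within2 , p , q , p≢q , p≁q) , ¬srg) =
    ¬srg (2 , 0 , 1 , regular , adjacent⇒codeg≡0 , nonadjacent⇒codeg≡1)
    where
    adjacent⇒codeg≡0 : ∀ u v → u ≢ v → Adj G u v → codeg G u v ≡ 0
    adjacent⇒codeg≡0 u v u≢v u~v with codeg∈ u v u≢v
    ... | inj₂ codeg≡0 = codeg≡0
    ... | inj₁ codeg≡1 with w , u~w , v~w ← 0<codeg⇒common-neighbour (subst (0 <_) (sym codeg≡1) z<s)
      = contradiction (2-regular-triangle⇒complete regular diameter2 u~v u~w v~w p≢q) p≁q

    nonadjacent⇒codeg≡1 : ∀ u v → u ≢ v → ¬ Adj G u v → codeg G u v ≡ 1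
    nonadjacent⇒codeg≡1 u v u≢v u≁v with within2 u v | codeg∈ u v u≢v
    ... | inj₁ u≡v                 | _            = contradiction u≡v u≢v
    ... | inj₂ (inj₁ u~v)          | _            = contradiction u~v u≁v
    ... | inj₂ (inj₂ _)            | inj₁ codeg≡1 = codeg≡1
    ... | inj₂ (inj₂ (w , u~w , w~v)) | inj₂ codeg≡0 =
      contradiction (subst (1 ≤_) codeg≡0 (common-neighbour⇒1≤codeg u~w (Adj-sym w~v))) λ ()

  ¬strictlyDeza-3+c-2+c-1+c : ∀ c → IsStrictlyDeza G (3 + c) (2 + c) (1 + c) →
                              ¬ (∀ v → 1 < sizeB G (2 + c) v)
  ¬strictlyDeza-3+c-2+c-1+c c (deza@(_ , _ , regular , codeg∈) , (_ , p , q , p≢q , p≁q) , _) β>1 =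
    deza-identity-unsatisfiable c
      (subst (λ d → d + 3 ≤ n) (regular p) (degree+3≤n p≢q p≁q codeg<degree))
      (β>1 p) (deza-identity deza p)
    where
    codeg≤b : codeg G q p ≤ 2 + c
    codeg≤b with codeg∈ q p (p≢q ∘ sym)
    ... | inj₁ codeg≡b = ≤-reflexive codeg≡b
    ... | inj₂ codeg≡a = ≤-trans (≤-reflexive codeg≡a) (n≤1+n _)
    codeg<degree : codeg G q p < degree G q
    codeg<degree = subst (codeg G q p <_) (sym (regular q)) (s≤s codeg≤b)

  strictlyDeza⇒b≢1+a : ∀ {k b a} → IsStrictlyDeza G k b a → k ≡ suc b →
                        (∀ v → 1 < sizeB G b v) → b ≢ suc a
  strictlyDeza⇒b≢1+a {a = zero}  strictlyDeza refl _   refl = ¬strictlyDeza-2-1-0 strictlyDeza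
  strictlyDeza⇒b≢1+a {a = suc c} strictlyDeza refl β>1 refl = ¬strictlyDeza-3+c-2+c-1+c c strictlyDeza β>1

  B-sym : ∀ {b u v} → InBc G b u v → InBc G b v u
  B-sym         (inj₁ refl)            = inj₁ refl
  B-sym {u = u} {v} (inj₂ (v≢u , codeg≡b)) = inj₂ (v≢u ∘ sym , trans (codeg-sym u v) codeg≡b)

  B-trans : ∀ {k b a} → IsDeza G k b a → k ≡ suc b → b ≢ suc a →
            ∀ {u v w} → InBc G b u v → InBc G b v w → InBc G b u w
  B-trans _ _ _ (inj₁ refl) w∈B[v] = w∈B[v]
  B-trans _ _ _ v∈B[u] (inj₁ refl) = v∈B[u]
  B-trans {k} {b} {a} (_ , a≤b , regular , codeg∈) k≡1+b b≢1+a {u} {v} {w}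
          (inj₂ (_ , codeg[v,u]≡b)) (inj₂ (_ , codeg[w,v]≡b)) with w ≟ u
  ... | yes w≡u = inj₁ w≡u
  ... | no  w≢u with codeg∈ w u w≢u
  ...   | inj₁ codeg≡b = inj₂ (w≢u , codeg≡b)
  ...   | inj₂ codeg≡a = inj₂ (w≢u , trans codeg≡a (b+b≤1+b+a⇒a≡b a≤b b≢1+a b+b≤1+b+a))
    where
    b+b≤1+b+a : b + b ≤ suc b + a
    b+b≤1+b+a = subst₂ _≤_ (cong₂ _+_ codeg[w,v]≡b codeg[v,u]≡b)
                           (cong₂ _+_ (trans (regular v) k≡1+b) codeg≡a)
                           (codeg+codeg≤degree+codeg w v u)

  B-isEquivalence : ∀ {k b a} → IsDeza G k b a → k ≡ suc b → b ≢ suc a → IsEquivalence (InBc G b)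
  B-isEquivalence deza k≡1+b b≢1+a = record
    { refl  = inj₁ refl
    ; sym   = B-sym
    ; trans = B-trans deza k≡1+b b≢1+a
    }

lemma13 : ∀ {n : ℕ} (G : Graph n) (k b a : ℕ) →
    IsStrictlyDeza G k b a →
    k ≡ suc b →
    (∀ v → 1 < sizeB G b v) →
    ∀ (u v : Fin n) →
    ∃ (λ w → InBc G b v w × InBc G b u w) →
    (∀ w → InBc G b v w → InBc G b u w) × (∀ w → InBc G b u w → InBc G b v w)
lemma13 G k b a strictlyDeza@(deza , _) k≡1+b β>1 u v (w , w∈B[v] , w∈B[u]) =
  overlapping-classes⊆ B-equiv w∈B[v] w∈B[u] , overlapping-classes⊆ B-equiv w∈B[u] w∈B[v]
  where
  B-equiv : IsEquivalence (InBc G b)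
  B-equiv = B-isEquivalence G deza k≡1+b (strictlyDeza⇒b≢1+a G strictlyDeza k≡1+b β>1)
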